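{- Let $k$ be a positive integer and $f$ a function. (1) If every $n$-vertex directed graph admits a global $k$-FT connectivity preserver with at most $f(n,k)$ edges, then every $n$-vertex directed graph $G$ and every pair $s,t\in V(G)$ admit an $s$-$t$ $k$-FT connectivity preserver with $O(f(n,k))$ edges. (2) If every $n$-vertex directed graph and every source vertex admit a single-source $k$-FT connectivity preserver with at most $f(n,k)$ edges, then every $n$-vertex directed graph admits a global $k$-FT connectivity preserver with $O(f(n,k))$ edges. (3) If every $n$-vertex directed graph admits an all-pairs $k$-FT connectivity preserver with at most $f(n,k)$ edges, then every $n$-vertex directed graph and every source vertex admit a single-source $k$-FT connectivity preserver with $O(f(n,k))$ edges. Analogous statements (1)–(3) hold for the $k$-connectivity preserver family ($s$-$t$, global, single-source, all-pairs $k$-connectivity preservers).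
   Context: For a directed graph $G$: $\mathrm{flow}(G,s,t)$ is the maximum number of edge-disjoint $s$-to-$t$ paths; $\lambda_G(s,t)=\min(\mathrm{flow}(G,s,t),\mathrm{flow}(G,t,s))$; $\lambda^k_G(s,t)=\min(\lambda_G(s,t),k)$; $\lambda(G)=\min_{s,t}\lambda_G(s,t)$ and $\lambda^k(G)=\min(\lambda(G),k)$. Subgraphs $H$ have $V(H)=V(G)$, $E(H)\subseteq E(G)$. $k$-FT family: $H$ is an $s$-$t$ $k$-FT connectivity preserver (for given $s,t$) if $\lambda^1_{H-F}(s,t)=\lambda^1_{G-F}(s,t)$ for all $F\subseteq E(G)$ with $|F|\le k$; a global one if $\lambda^1(H-F)=\lambda^1(G-F)$ for all such $F$; a single-source one (for given $s$) if $\lambda^1_{H-F}(s,t)=\lambda^1_{G-F}(s,t)$ for all $t\in V$ and all such $F$; an all-pairs one if this holds for all $s,t\in V$ and all such $F$. $k$-connectivity family: $H$ is an $s$-$t$ $k$-connectivity preserver if $\lambda^k_H(s,t)=\lambda^k_G(s,t)$; global if $\lambda^k(H)=\lambda^k(G)$; single-source (for given $s$) if $\lambda^k_H(s,t)=\lambda^k_G(s,t)$ for all $t$; all-pairs if $\lambda^k_H(s,t)=\lambda^k_G(s,t)$ for all $s,t$. -}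

module Defs where

open import Data.Nat using (ℕ; _≤_; _*_)
open import Data.Fin using (Fin)
open import Data.Fin.Subset using (Subset; ⊤; ∁; _∩_; ∣_∣) renaming (_∈_ to _∈ₛ_)
open import Data.Vec using (Vec; lookup)
open import Data.List using (List; []; _∷_)
open import Data.List.Membership.Propositional using (_∈_)
open import Data.List.Relation.Unary.All using (All)
open import Data.List.Relation.Unary.Unique.Propositional using (Unique)
open import Data.Product using (Σ; _×_; proj₁; proj₂)
open import Data.Empty using (⊥)
open import Relation.Binary.PropositionalEquality using (_≡_; _≢_)
open import Function.Bundles using (_⇔_)

-- Parallel edges and loops are allowed; edges have identities (Fin m).
record Digraph (n : ℕ) : Set where
  field
    m     : ℕ
    edges : Vec (Fin n × Fin n) m
open Digraph public

-- A subgraph H of G (V(H) = V(G), E(H) ⊆ E(G)) is a subset of the edge indices.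
EdgeSet : ∀ {n} → Digraph n → Set
EdgeSet G = Subset (m G)

tail head : ∀ {n} (G : Digraph n) → Fin (m G) → Fin n
tail G e = proj₁ (lookup (edges G) e)
head G e = proj₂ (lookup (edges G) e)

IsWalk : ∀ {n} (G : Digraph n) → EdgeSet G → Fin n → Fin n → List (Fin (m G)) → Set
IsWalk G S s t []       = s ≡ t
IsWalk G S s t (e ∷ es) = (e ∈ₛ S) × (tail G e ≡ s) × IsWalk G S (head G e) t es

vertices : ∀ {n} (G : Digraph n) → Fin n → List (Fin (m G)) → List (Fin n)
vertices G s []       = s ∷ []
vertices G s (e ∷ es) = s ∷ vertices G (head G e) es

IsPath : ∀ {n} (G : Digraph n) → EdgeSet G → Fin n → Fin n → List (Fin (m G)) → Set
IsPath G S s t es = IsWalk G S s t es × Unique (vertices G s es)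

-- flow(G[S], s, t) ≥ j : there are j pairwise edge-disjoint s-to-t paths in
-- the subgraph with edge set S.
FlowAtLeast : ∀ {n} (G : Digraph n) → EdgeSet G → Fin n → Fin n → ℕ → Set
FlowAtLeast G S s t j =
  Σ (Vec (List (Fin (m G))) j) λ ps →
    ((i : Fin j) → IsPath G S s t (lookup ps i)) ×
    ((i i' : Fin j) → i ≢ i' → (e : Fin (m G)) →
       e ∈ lookup ps i → e ∈ lookup ps i' → ⊥)

-- λᵏ_{G[S]}(s,t) ≥ j   (λᵏ = min(flow s→t, flow t→s, k))
LamKAtLeast : ∀ {n} (k : ℕ) (G : Digraph n) → EdgeSet G → Fin n → Fin n → ℕ → Set
LamKAtLeast k G S s t j = (j ≤ k) × FlowAtLeast G S s t j × FlowAtLeast G S t s j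

-- λᵏ(G[S]) ≥ j   (λ = min over all pairs s,t of λ(s,t))
GlobalLamKAtLeast : ∀ {n} (k : ℕ) (G : Digraph n) → EdgeSet G → ℕ → Set
GlobalLamKAtLeast k G S j =
  (j ≤ k) × ((s t : Fin _) → FlowAtLeast G S s t j × FlowAtLeast G S t s j)

-- λᵏ_{G[S]}(s,t) = λᵏ_{G[S']}(s,t)  (equality of values ⇔ equality of
-- their sets of lower bounds)
SameLamK : ∀ {n} (k : ℕ) (G : Digraph n) → EdgeSet G → EdgeSet G → Fin n → Fin n → Set
SameLamK k G S S' s t = (j : ℕ) → LamKAtLeast k G S s t j ⇔ LamKAtLeast k G S' s t j

SameGlobalLamK : ∀ {n} (k : ℕ) (G : Digraph n) → EdgeSet G → EdgeSet G → Set
SameGlobalLamK k G S S' = (j : ℕ) → GlobalLamKAtLeast k G S j ⇔ GlobalLamKAtLeast k G S' j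

minus : ∀ {n} (G : Digraph n) → EdgeSet G → EdgeSet G → EdgeSet G
minus G H F = H ∩ ∁ F

STFTPreserver : ∀ {n} (k : ℕ) (G : Digraph n) (s t : Fin n) → EdgeSet G → Set
STFTPreserver k G s t H =
  (F : EdgeSet G) → ∣ F ∣ ≤ k → SameLamK 1 G (minus G H F) (minus G ⊤ F) s t

GlobalFTPreserver : ∀ {n} (k : ℕ) (G : Digraph n) → EdgeSet G → Set
GlobalFTPreserver k G H =
  (F : EdgeSet G) → ∣ F ∣ ≤ k → SameGlobalLamK 1 G (minus G H F) (minus G ⊤ F)

SSFTPreserver : ∀ {n} (k : ℕ) (G : Digraph n) (s : Fin n) → EdgeSet G → Set
SSFTPreserver k G s H =
  (F : EdgeSet G) → ∣ F ∣ ≤ k → (t : Fin _) → SameLamK 1 G (minus G H F) (minus G ⊤ F) s t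

APFTPreserver : ∀ {n} (k : ℕ) (G : Digraph n) → EdgeSet G → Set
APFTPreserver k G H =
  (F : EdgeSet G) → ∣ F ∣ ≤ k → (s t : Fin _) → SameLamK 1 G (minus G H F) (minus G ⊤ F) s t

STConPreserver : ∀ {n} (k : ℕ) (G : Digraph n) (s t : Fin n) → EdgeSet G → Set
STConPreserver k G s t H = SameLamK k G H ⊤ s t

GlobalConPreserver : ∀ {n} (k : ℕ) (G : Digraph n) → EdgeSet G → Set
GlobalConPreserver k G H = SameGlobalLamK k G H ⊤

SSConPreserver : ∀ {n} (k : ℕ) (G : Digraph n) (s : Fin n) → EdgeSet G → Set
SSConPreserver k G s H = (t : Fin _) → SameLamK k G H ⊤ s t

APConPreserver : ∀ {n} (k : ℕ) (G : Digraph n) → EdgeSet G → Set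
APConPreserver k G H = (s t : Fin _) → SameLamK k G H ⊤ s t

AllST : (k : ℕ) → (∀ {n} (k : ℕ) (G : Digraph n) (s t : Fin n) → EdgeSet G → Set) →
        (ℕ → ℕ) → Set
AllST k P B = (n : ℕ) (G : Digraph n) (s t : Fin n) →
  Σ (EdgeSet G) λ H → (∣ H ∣ ≤ B n) × P k G s t H

AllSS : (k : ℕ) → (∀ {n} (k : ℕ) (G : Digraph n) (s : Fin n) → EdgeSet G → Set) →
        (ℕ → ℕ) → Set
AllSS k P B = (n : ℕ) (G : Digraph n) (s : Fin n) →
  Σ (EdgeSet G) λ H → (∣ H ∣ ≤ B n) × P k G s H

AllG : (k : ℕ) → (∀ {n} (k : ℕ) (G : Digraph n) → EdgeSet G → Set) →
       (ℕ → ℕ) → Set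
AllG k P B = (n : ℕ) (G : Digraph n) →
  Σ (EdgeSet G) λ H → (∣ H ∣ ≤ B n) × P k G H

{-# OPTIONS --safe #-}
module Submission where

-- (3) is immediate: an all-pairs preserver is a single-source preserver for every source.
--
-- (2) rests on the transitivity  flow(u,v) ≥ min(flow(u,w), flow(w,v))  of edge connectivity:
-- a single-source preserver for the source 0 keeps every λ(0,x) and λ(x,0), hence every λ(a,b).
-- For transitivity, augment a 0/1 flow from u to v along residual paths. Either it reaches value
-- J and then splits into J edge-disjoint paths, or augmentation stops at a set R ∋ u, ∌ v that no
-- residual edge leaves; then every flow across R has value at most the current one, below J,
-- although the J paths u → w or the J paths w → v form a flow of value J across R.
--
-- (1) Let G⁺ be G with k parallel arcs v → s and k parallel arcs t → v added for every vertex v.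
-- If G has j ≤ k edge-disjoint s-t paths, G⁺ is globally j-connected; conversely every s-t walk of
-- G⁺ ends with an s-t walk of G. Hence a global preserver of G⁺ restricted to the edges of G
-- keeps the s → t connectivity of G, and together with the one built for (t, s) it gives an s-t
-- preserver with at most 2 f(n,k) edges. Faults are edges of G, so they never hit the new arcs.

open import Defs
open import Data.Nat using (ℕ; zero; suc)
open import Data.Product using (Σ; _×_; _,_; proj₁; proj₂; swap)
open import Data.Sum using (_⊎_; inj₁; inj₂; [_,_]′; reduce)
open import Data.Empty using (⊥-elim)
open import Data.Bool using (Bool; true; false; not; if_then_else_)
open import Data.Bool.Properties using (not-involutive)
open import Data.Fin using (Fin; zero; suc; _↑ˡ_; _↑ʳ_; splitAt; combine; remQuot; inject≤)
import Data.Fin.Properties as Fin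
open import Data.Fin.Subset using (Subset; ⊤; ⊥; ⁅_⁆; _∪_; ∁; ∣_∣)
  renaming (_∈_ to _∈ₛ_; _∉_ to _∉ₛ_; _⊆_ to _⊆ₛ_)
open import Data.Fin.Subset.Properties
  using (∈⊤; ⊆⊤; ∉⊥; ⊥⊆; ∣⊥∣≡0; ∣p∣≤n; p⊂q⇒∣p∣<∣q∣; x∈⁅x⁆; x∈⁅y⁆⇒x≡y;
         p⊆p∪q; q⊆p∪q; x∈p∪q⁻; x∈p∪q⁺; x∈p∩q⁺; x∈p∩q⁻; x∉p⇒x∈∁p; x∈∁p⇒x∉p)
  renaming (_∈?_ to _∈?ₛ_)
open import Data.Vec using (Vec; []; _∷_; lookup; tabulate; _[_]%=_) renaming (_++_ to _++ᵥ_)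
open import Data.Vec.Properties
  using (lookup∘tabulate; lookup∘updateAt; lookup∘updateAt′; lookup-replicate; lookup-++ˡ; lookup-++ʳ;
         []=⇒lookup; lookup⇒[]=)
import Data.Vec.Functional as Vector
open import Data.List using (List; []; _∷_; _++_; map)
open import Data.List.Membership.Propositional using (_∈_; _∉_)
open import Data.List.Membership.Propositional.Properties using (∈-map⁻; ∈-++⁻)
open import Data.List.Relation.Unary.Any using (here; there; any?)
open import Data.List.Relation.Unary.All using (All; [])
import Data.List.Relation.Unary.All as All
open import Data.List.Relation.Unary.All.Properties using (¬Any⇒All¬; All¬⇒¬Any)
open import Data.List.Relation.Unary.AllPairs using ([]; _∷_)
open import Data.List.Relation.Unary.Unique.Propositional using (Unique)
open import Data.List.Relation.Binary.Subset.Propositional using (_⊆_)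
open import Function using (id; _∘_)
open import Function.Bundles using (mk⇔; Equivalence)
open import Relation.Binary.PropositionalEquality
open import Relation.Nullary using (Dec; yes; no; ¬?; does)
open import Relation.Nullary.Decidable using (_×-dec_; decidable-stable)

_∈?_ : ∀ {k} (x : Fin k) (xs : List (Fin k)) → Dec (x ∈ xs)
x ∈? xs = any? (x Fin.≟_) xs

Disjoint : ∀ {A : Set} {j} → (Fin j → List A) → Set
Disjoint {j = j} P = (i i' : Fin j) → i ≢ i' → ∀ x → x ∈ P i → x ∉ P i'

Disjoint-reflect : ∀ {A B : Set} {j} (f : A → B) {P : Fin j → List A} {Q : Fin j → List B} →
                   (∀ i {x} → x ∈ P i → f x ∈ Q i) → Disjoint Q → Disjoint P
Disjoint-reflect f P⇒Q disjoint i i' i≢i' x x∈Pi x∈Pi' =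
  disjoint i i' i≢i' (f x) (P⇒Q i x∈Pi) (P⇒Q i' x∈Pi')

Disjoint-∷ : ∀ {A : Set} {j} {p : List A} {P : Fin j → List A} →
             (∀ i {x} → x ∈ p → x ∉ P i) → Disjoint P → Disjoint (p Vector.∷ P)
Disjoint-∷ p#P disjoint zero    zero     0≢0  = ⊥-elim (0≢0 refl)
Disjoint-∷ p#P disjoint zero    (suc i') _    x x∈p x∈P = p#P i' x∈p x∈P
Disjoint-∷ p#P disjoint (suc i) zero     _    x x∈P x∈p = p#P i x∈p x∈P
Disjoint-∷ p#P disjoint (suc i) (suc i') i≢i' = disjoint i i' (i≢i' ∘ cong suc)

Disjoint-tail : ∀ {A : Set} {j} {P : Fin (suc j) → List A} → Disjoint P → Disjoint (P ∘ suc)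
Disjoint-tail disjoint i i' i≢i' = disjoint (suc i) (suc i') (i≢i' ∘ Fin.suc-injective)

module Walks {n : ℕ} (G : Digraph n) where

  private
    Edge : Set
    Edge = Fin (m G)

  walk-edges : ∀ {S a b} es → IsWalk G S a b es → ∀ {e} → e ∈ es → e ∈ₛ S
  walk-edges (e ∷ es) (e∈S , _ , _) (here refl)  = e∈S
  walk-edges (e ∷ es) (_ , _ , w)   (there e∈es) = walk-edges es w e∈es

  IsWalk-mono : ∀ {S S' a b} es → S ⊆ₛ S' → IsWalk G S a b es → IsWalk G S' a b es
  IsWalk-mono []       S⊆S' a≡b              = a≡b
  IsWalk-mono (e ∷ es) S⊆S' (e∈S , tail≡a , w) = S⊆S' e∈S , tail≡a , IsWalk-mono es S⊆S' w

  IsWalk-++ : ∀ {S a b c} p q → IsWalk G S a b p → IsWalk G S b c q → IsWalk G S a c (p ++ q)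
  IsWalk-++ []      q refl                wq = wq
  IsWalk-++ (e ∷ p) q (e∈S , tail≡a , wp) wq = e∈S , tail≡a , IsWalk-++ p q wp wq

  path-suffix : ∀ {S x a b} p → IsPath G S x b p → a ∈ vertices G x p →
                Σ (List Edge) λ q → IsPath G S a b q × q ⊆ p
  path-suffix []      path (here refl) = [] , path , id
  path-suffix (e ∷ p) path (here refl) = e ∷ p , path , id
  path-suffix (e ∷ p) ((_ , _ , w) , _ ∷ distinct) (there a∈) =
    let q , q-path , q⊆p = path-suffix p (w , distinct) a∈ in q , q-path , there ∘ q⊆p

  walk⇒path : ∀ {S a b} es → IsWalk G S a b es → Σ (List Edge) λ p → IsPath G S a b p × p ⊆ es
  walk⇒path []       refl = [] , (refl , [] ∷ []) , id
  walk⇒path {a = a} (e ∷ es) (e∈S , tail≡a , w) with walk⇒path es w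
  ... | p , (p-walk , distinct) , p⊆es with a ∈? vertices G (head G e) p
  ...   | yes a∈ = let q , q-path , q⊆p = path-suffix p (p-walk , distinct) a∈ in q , q-path , there ∘ p⊆es ∘ q⊆p
  ...   | no  a∉ = e ∷ p , ((e∈S , tail≡a , p-walk) , ¬Any⇒All¬ _ a∉ ∷ distinct) ,
                   λ { (here refl) → here refl ; (there x∈p) → there (p⊆es x∈p) }

  private
    tail∈vertices : ∀ {S a b} es → IsWalk G S a b es → ∀ {e} → e ∈ es → tail G e ∈ vertices G a es
    tail∈vertices (e ∷ es) (_ , tail≡a , _) (here refl)  = here tail≡a
    tail∈vertices (e ∷ es) (_ , _ , w)      (there e∈es) = there (tail∈vertices es w e∈es)

  -- a repeated edge would revisit its tail
  path-edges-unique : ∀ {S a b} p → IsPath G S a b p → Unique p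
  path-edges-unique []      _ = []
  path-edges-unique (e ∷ p) ((_ , tail≡a , w) , a∉rest ∷ distinct) =
    ¬Any⇒All¬ p (λ e∈p → All.lookup a∉rest (tail∈vertices p w e∈p) (sym tail≡a)) ∷
    path-edges-unique p (w , distinct)

  WalksAtLeast : EdgeSet G → Fin n → Fin n → ℕ → Set
  WalksAtLeast S a b j = Σ (Fin j → List Edge) λ W → ((i : Fin j) → IsWalk G S a b (W i)) × Disjoint W

  walks-mono : ∀ {S S' a b j} → S ⊆ₛ S' → WalksAtLeast S a b j → WalksAtLeast S' a b j
  walks-mono S⊆S' (W , walks , disjoint) = W , (λ i → IsWalk-mono (W i) S⊆S' (walks i)) , disjoint

  walks⇒flow : ∀ {S a b j} → WalksAtLeast S a b j → FlowAtLeast G S a b j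
  walks⇒flow {S} {a} {b} (W , walks , disjoint) =
    tabulate P ,
    (λ i → subst (IsPath G S a b) (sym (lookup∘tabulate P i)) (proj₁ (proj₂ (shortcut i)))) ,
    Disjoint-reflect id (λ i → proj₂ (proj₂ (shortcut i)) ∘ subst (_ ∈_) (lookup∘tabulate P i)) disjoint
    where
    shortcut = λ i → walk⇒path (W i) (walks i)
    P = λ i → proj₁ (shortcut i)

  flow-mono : ∀ {S S' a b j} → S ⊆ₛ S' → FlowAtLeast G S a b j → FlowAtLeast G S' a b j
  flow-mono S⊆S' (ps , paths , disjoint) =
    ps , (λ i → IsWalk-mono (lookup ps i) S⊆S' (proj₁ (paths i)) , proj₂ (paths i)) , disjoint

module Reachability {n : ℕ} (D : Digraph n) (T : EdgeSet D) where

  open import Data.Nat using (_≤_; _+_; _<_)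
  open import Data.Nat.Properties using (m≤m+n; +-suc; ≤-trans; ≤-reflexive; +-monoʳ-≤; <⇒≱)
  open Walks D

  Reachable : Fin n → Fin n → Set
  Reachable a x = Σ (List (Fin (m D))) (IsWalk D T a x)

  Closed : Subset n → Set
  Closed R = ∀ {e} → e ∈ₛ T → tail D e ∈ₛ R → head D e ∈ₛ R

  private
    Leaving : Subset n → Fin (m D) → Set
    Leaving R e = e ∈ₛ T × tail D e ∈ₛ R × head D e ∉ₛ R

    extend : ∀ {a R e} → (∀ {x} → x ∈ₛ R → Reachable a x) → Leaving R e →
             ∀ {x} → x ∈ₛ R ∪ ⁅ head D e ⁆ → Reachable a x
    extend {R = R} {e} reach (e∈T , t∈R , _) x∈ with x∈p∪q⁻ R _ x∈
    ... | inj₁ x∈R = reach x∈R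
    ... | inj₂ x∈h = let es , w = reach t∈R in
      subst (Reachable _) (sym (x∈⁅y⁆⇒x≡y _ x∈h)) (es ++ e ∷ [] , IsWalk-++ es (e ∷ []) w (e∈T , refl , refl))

    grows : ∀ (R : Subset n) {x} → x ∉ₛ R → ∣ R ∣ < ∣ R ∪ ⁅ x ⁆ ∣
    grows R {x} x∉R = p⊂q⇒∣p∣<∣q∣ (p⊆p∪q ⁅ x ⁆ , x , x∈p∪q⁺ (inj₂ (x∈⁅x⁆ x)) , x∉R)

    saturate : ∀ {a} fuel R → n ≤ fuel + ∣ R ∣ → a ∈ₛ R → (∀ {x} → x ∈ₛ R → Reachable a x) →
               Σ (Subset n) λ R' → a ∈ₛ R' × (∀ {x} → x ∈ₛ R' → Reachable a x) × Closed R'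
    saturate fuel R bound a∈R reach
      with Fin.any? (λ e → (e ∈?ₛ T) ×-dec (tail D e ∈?ₛ R) ×-dec ¬? (head D e ∈?ₛ R))
    ... | no none = R , a∈R , reach ,
          λ {e} e∈T t∈R → decidable-stable (head D e ∈?ₛ R) (λ h∉R → none (e , e∈T , t∈R , h∉R))
    ... | yes (e , leaving@(_ , _ , h∉R)) with fuel
    ...   | zero     = ⊥-elim (<⇒≱ (≤-trans (grows R h∉R) (∣p∣≤n (R ∪ ⁅ head D e ⁆))) bound)
    ...   | suc fuel = saturate fuel (R ∪ ⁅ head D e ⁆)
                         (≤-trans bound (≤-trans (≤-reflexive (sym (+-suc fuel ∣ R ∣))) (+-monoʳ-≤ fuel (grows R h∉R))))
                         (p⊆p∪q _ a∈R) (extend reach leaving)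

  reachable-or-cut : ∀ a b → Reachable a b ⊎ Σ (Subset n) λ R → a ∈ₛ R × b ∉ₛ R × Closed R
  reachable-or-cut a b with saturate n ⁅ a ⁆ (m≤m+n n _) (x∈⁅x⁆ a) (λ x∈ → [] , sym (x∈⁅y⁆⇒x≡y a x∈))
  ... | R , a∈R , reach , closed with b ∈?ₛ R
  ...   | yes b∈R = inj₁ (reach b∈R)
  ...   | no  b∉R = inj₂ (R , a∈R , b∉R , closed)

lookup-∉ : ∀ {k} {A : Subset k} {x} → x ∉ₛ A → lookup A x ≡ false
lookup-∉ {A = A} {x} x∉A with lookup A x in eq
... | true  = ⊥-elim (x∉A (lookup⇒[]= x A eq))
... | false = refl

toggle : ∀ {k} → Fin k → Subset k → Subset k
toggle e X = X [ e ]%= not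

toggleAll : ∀ {k} → List (Fin k) → Subset k → Subset k
toggleAll []       X = X
toggleAll (e ∷ es) X = toggleAll es (toggle e X)

toggleAll-∉ : ∀ {k} es {X : Subset k} {x} → x ∉ es → lookup (toggleAll es X) x ≡ lookup X x
toggleAll-∉ []       x∉es = refl
toggleAll-∉ (e ∷ es) {X} {x} x∉es = trans (toggleAll-∉ es (x∉es ∘ there)) (lookup∘updateAt′ x e (x∉es ∘ here) X)

toggleAll-∉-∈ : ∀ {k} es {X : Subset k} {x} → x ∉ es → x ∈ₛ toggleAll es X → x ∈ₛ X
toggleAll-∉-∈ es {X} {x} x∉es x∈X' = lookup⇒[]= x X (trans (sym (toggleAll-∉ es x∉es)) ([]=⇒lookup x∈X'))

toggleAll-∈ : ∀ {k} es {X : Subset k} {x} → Unique es → x ∈ es → lookup (toggleAll es X) x ≡ not (lookup X x)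
toggleAll-∈ (e ∷ es) {X} (e∉es ∷ _) (here refl) = trans (toggleAll-∉ es (All¬⇒¬Any e∉es)) (lookup∘updateAt e X)
toggleAll-∈ (e ∷ es) {X} {x} (e∉es ∷ distinct) (there x∈es) =
  trans (toggleAll-∈ es distinct x∈es) (cong not (lookup∘updateAt′ x e (≢-sym (All.lookup e∉es x∈es)) X))

toggleAll-removes : ∀ {k} es {X : Subset k} → Unique es → (∀ {x} → x ∈ es → x ∈ₛ X) →
                    ∀ {x} → x ∈ es → x ∉ₛ toggleAll es X
toggleAll-removes es {X} distinct es⊆X x∈es x∈X'
  with () ← trans (sym ([]=⇒lookup x∈X')) (trans (toggleAll-∈ es distinct x∈es) (cong not ([]=⇒lookup (es⊆X x∈es))))

toggleAll-⊆ : ∀ {k} es {X : Subset k} → Unique es → (∀ {x} → x ∈ es → x ∈ₛ X) → toggleAll es X ⊆ₛ X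
toggleAll-⊆ es distinct es⊆X {x} x∈X' with x ∈? es
... | yes x∈es = ⊥-elim (toggleAll-removes es distinct es⊆X x∈es x∈X')
... | no  x∉es = toggleAll-∉-∈ es x∉es x∈X'

toggleAll-involutive : ∀ {k} {X : Subset k} es → Unique es → ∀ x → lookup (toggleAll es (toggleAll es X)) x ≡ lookup X x
toggleAll-involutive es distinct x with x ∈? es
... | yes x∈es = trans (toggleAll-∈ es distinct x∈es) (trans (cong not (toggleAll-∈ es distinct x∈es)) (not-involutive _))
... | no  x∉es = trans (toggleAll-∉ es x∉es) (toggleAll-∉ es x∉es)

module Menger where

  open import Data.Nat as ℕ using ()
  open import Data.Nat.Properties using (<⇒≤; <⇒≱; ≤-refl; n≮0)
  open import Data.Integer using (ℤ; +_; 0ℤ; 1ℤ; _+_; _-_; -_; _*_; _≤_; +≤+; -≤+)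
  import Data.Integer.Properties as ℤ
  open import Data.Integer.Tactic.RingSolver using (solve-∀)
  open import Algebra.Properties.Semiring.Sum ℤ.+-*-semiring
    using (sum; sum-syntax; sum-cong-≗; ∑-distrib-+; ∑-comm; *-distribˡ-sum; sum-replicate-zero)

  𝟙 : Bool → ℤ
  𝟙 true  = 1ℤ
  𝟙 false = 0ℤ

  χ : ∀ {k} → Subset k → Fin k → ℤ
  χ A x = 𝟙 (lookup A x)

  δ : ∀ {k} → Fin k → Fin k → ℤ
  δ a x = 𝟙 (does (a Fin.≟ x))

  ∑-δ : ∀ {k} (f : Fin k → ℤ) a → ∑[ x < k ] (δ a x * f x) ≡ f a
  ∑-δ {suc k} f zero = begin
    1ℤ * f zero + ∑[ x < k ] 0ℤ  ≡⟨ cong₂ _+_ (ℤ.*-identityˡ (f zero)) (sum-replicate-zero k) ⟩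
    f zero + 0ℤ                   ≡⟨ ℤ.+-identityʳ (f zero) ⟩
    f zero                        ∎
    where open ≡-Reasoning
  ∑-δ {suc k} f (suc a) = trans (ℤ.+-identityˡ _) (∑-δ (f ∘ suc) a)

  ∑-δ-difference : ∀ {k} (f : Fin k → ℤ) a b → ∑[ x < k ] (f x * (δ a x - δ b x)) ≡ f a - f b
  ∑-δ-difference {k} f a b = begin
    ∑[ x < k ] (f x * (δ a x - δ b x))
      ≡⟨ sum-cong-≗ (λ x → split (f x) (δ a x) (δ b x)) ⟩
    ∑[ x < k ] (δ a x * f x + δ b x * - f x)
      ≡⟨ ∑-distrib-+ (λ x → δ a x * f x) (λ x → δ b x * - f x) ⟩
    ∑[ x < k ] (δ a x * f x) + ∑[ x < k ] (δ b x * - f x)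
      ≡⟨ cong₂ _+_ (∑-δ f a) (∑-δ (-_ ∘ f) b) ⟩
    f a - f b
      ∎
    where
    open ≡-Reasoning
    split : ∀ y α β → y * (α - β) ≡ α * y + β * - y
    split = solve-∀

  ∑-mono-≤ : ∀ {k} {f g : Fin k → ℤ} → (∀ x → f x ≤ g x) → sum f ≤ sum g
  ∑-mono-≤ {zero}  f≤g = ℤ.≤-refl
  ∑-mono-≤ {suc k} f≤g = ℤ.+-mono-≤ (f≤g zero) (∑-mono-≤ (f≤g ∘ suc))

  incidence : ∀ {n} (D : Digraph n) → Fin (m D) → Fin n → ℤ
  incidence D e x = δ (tail D e) x - δ (head D e) x

  module _ {n : ℕ} (G : Digraph n) where

    open Walks G

    private
      Edge : Set
      Edge = Fin (m G)

    withEdges : Vec (Fin n × Fin n) (m G) → Digraph n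
    withEdges E = record { m = m G ; edges = E }

    IsWalk-transport : ∀ {E E' S a b} p → (∀ {e} → e ∈ p → lookup E e ≡ lookup E' e) →
                       IsWalk (withEdges E) S a b p → IsWalk (withEdges E') S a b p
    IsWalk-transport []      _    a≡b = a≡b
    IsWalk-transport {E' = E'} {S} {b = b} (e ∷ p) same (e∈S , tail≡a , w) =
      e∈S , trans (cong proj₁ (sym (same (here refl)))) tail≡a ,
      subst (λ x → IsWalk (withEdges E') S x b p) (cong proj₂ (same (here refl))) (IsWalk-transport p (same ∘ there) w)

    orient : Bool → Fin n × Fin n → Fin n × Fin n
    orient true  = swap
    orient false = id

    residual : EdgeSet G → Digraph n
    residual X = withEdges (tabulate λ e → orient (lookup X e) (lookup (edges G) e))

    residual-edge : ∀ X e → lookup (edges (residual X)) e ≡ orient (lookup X e) (lookup (edges G) e)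
    residual-edge X e = lookup∘tabulate _ e

    residual-∈ : ∀ {X e} → e ∈ₛ X → lookup (edges (residual X)) e ≡ swap (lookup (edges G) e)
    residual-∈ {X} {e} e∈X = trans (residual-edge X e) (cong (λ β → orient β _) ([]=⇒lookup e∈X))

    residual-∉ : ∀ {X e} → e ∉ₛ X → lookup (edges (residual X)) e ≡ lookup (edges G) e
    residual-∉ {X} {e} e∉X = trans (residual-edge X e) (cong (λ β → orient β _) (lookup-∉ e∉X))

    residual-walk : ∀ {X S a b} p → (∀ {e} → e ∈ p → e ∉ₛ X) → IsWalk G S a b p → IsWalk (residual X) S a b p
    residual-walk p p∉X = IsWalk-transport p (sym ∘ residual-∉ ∘ p∉X)

    residual-toggle : ∀ {X T a b e} p → All (e ≢_) p → IsWalk (residual X) T a b p →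
                      IsWalk (residual (toggle e X)) T a b p
    residual-toggle {X} {e = e} p e∉p = IsWalk-transport p λ {e'} e'∈p → begin
      lookup (edges (residual X)) e'
        ≡⟨ residual-edge X e' ⟩
      orient (lookup X e') _
        ≡⟨ cong (λ β → orient β _) (lookup∘updateAt′ e' e (≢-sym (All.lookup e∉p e'∈p)) X) ⟨
      orient (lookup (toggle e X) e') _
        ≡⟨ residual-edge (toggle e X) e' ⟨
      lookup (edges (residual (toggle e X))) e'
        ∎
      where open ≡-Reasoning

    incidence-residual : ∀ X e x → incidence (residual X) e x ≡ (if lookup X e then - incidence G e x else incidence G e x)
    incidence-residual X e x with lookup X e | residual-edge X e
    ... | true  | edge = trans (cong (λ p → δ (proj₁ p) x - δ (proj₂ p) x) edge) (negate (δ (tail G e) x) (δ (head G e) x))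
      where
      negate : ∀ α β → β - α ≡ - (α - β)
      negate = solve-∀
    ... | false | edge = cong (λ p → δ (proj₁ p) x - δ (proj₂ p) x) edge

    net : EdgeSet G → Fin n → ℤ
    net X x = ∑[ e < m G ] (χ X e * incidence G e x)

    net-cong : ∀ {X X'} → (∀ e → lookup X e ≡ lookup X' e) → ∀ x → net X x ≡ net X' x
    net-cong X≗X' x = sum-cong-≗ (λ e → cong (λ β → 𝟙 β * incidence G e x) (X≗X' e))

    net-toggle : ∀ X e x → net (toggle e X) x ≡ net X x + incidence (residual X) e x
    net-toggle X e x = begin
      net (toggle e X) x
        ≡⟨ sum-cong-≗ pointwise ⟩
      ∑[ e' < m G ] (χ X e' * incidence G e' x + δ e e' * flipped)
        ≡⟨ ∑-distrib-+ (λ e' → χ X e' * incidence G e' x) (λ e' → δ e e' * flipped) ⟩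
      net X x + ∑[ e' < m G ] (δ e e' * flipped)
        ≡⟨ cong (λ σ → net X x + σ) (∑-δ (λ _ → flipped) e) ⟩
      net X x + flipped
        ∎
      where
      open ≡-Reasoning
      flipped = incidence (residual X) e x
      pointwise : ∀ e' → χ (toggle e X) e' * incidence G e' x ≡ χ X e' * incidence G e' x + δ e e' * flipped
      pointwise e' with e Fin.≟ e'
      ... | no e≢e' = begin
        χ (toggle e X) e' * incidence G e' x
          ≡⟨ cong (λ β → 𝟙 β * incidence G e' x) (lookup∘updateAt′ e' e (≢-sym e≢e') X) ⟩
        χ X e' * incidence G e' x
          ≡⟨ ℤ.+-identityʳ _ ⟨
        χ X e' * incidence G e' x + 0ℤ * flipped
          ∎
      ... | yes refl = begin
        χ (toggle e X) e * incidence G e x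
          ≡⟨ cong (λ β → 𝟙 β * incidence G e x) (lookup∘updateAt e X) ⟩
        𝟙 (not (lookup X e)) * incidence G e x
          ≡⟨ toggled-term (lookup X e) (incidence G e x) ⟩
        χ X e * incidence G e x + 1ℤ * (if lookup X e then - incidence G e x else incidence G e x)
          ≡⟨ cong (λ ι → χ X e * incidence G e x + 1ℤ * ι) (incidence-residual X e x) ⟨
        χ X e * incidence G e x + 1ℤ * flipped
          ∎
        where
        toggled-term : ∀ β ι → 𝟙 (not β) * ι ≡ 𝟙 β * ι + 1ℤ * (if β then - ι else ι)
        toggled-term true  = removed
          where
          removed : ∀ ι → 0ℤ * ι ≡ 1ℤ * ι + 1ℤ * - ι
          removed = solve-∀
        toggled-term false = added
          where
          added : ∀ ι → 1ℤ * ι ≡ 0ℤ * ι + 1ℤ * ι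
          added = solve-∀

    augment : ∀ {X T a b} p → IsWalk (residual X) T a b p → Unique p →
              ∀ x → net (toggleAll p X) x ≡ net X x + (δ a x - δ b x)
    augment {X} {a = a} [] refl [] x = sym (cancel (net X x) (δ a x))
      where
      cancel : ∀ ν α → ν + (α - α) ≡ ν
      cancel = solve-∀
    augment {X} {b = b} (e ∷ p) (_ , refl , w) (e∉p ∷ distinct) x = begin
      net (toggleAll p (toggle e X)) x                        ≡⟨ augment p (residual-toggle {X} p e∉p w) distinct x ⟩
      net (toggle e X) x + (δ h x - δ b x)                    ≡⟨ cong (_+ (δ h x - δ b x)) (net-toggle X e x) ⟩
      net X x + (δ t x - δ h x) + (δ h x - δ b x)             ≡⟨ telescope (net X x) (δ t x) (δ h x) (δ b x) ⟩
      net X x + (δ t x - δ b x)                               ∎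
      where
      open ≡-Reasoning
      t = tail (residual X) e
      h = head (residual X) e
      telescope : ∀ ν α β γ → ν + (α - β) + (β - γ) ≡ ν + (α - γ)
      telescope = solve-∀

    record IsFlow (X : EdgeSet G) (j : ℕ) (a b : Fin n) : Set where
      constructor conserves
      field net-value : ∀ x → net X x ≡ + j * (δ a x - δ b x)
    open IsFlow

    empty-flow : ∀ {a b} → IsFlow ⊥ 0 a b
    empty-flow = conserves λ x →
      trans (sum-cong-≗ (λ e → cong (λ β → 𝟙 β * incidence G e x) (lookup-replicate e false))) (sum-replicate-zero (m G))

    augment-flow : ∀ {X S j a b} p → X ⊆ₛ S → IsFlow X j a b → IsWalk (residual X) S a b p → Unique p →
                   toggleAll p X ⊆ₛ S × IsFlow (toggleAll p X) (suc j) a b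
    augment-flow {X} {j = j} {a} {b} p X⊆S flow w distinct = toggled⊆S ,
      conserves λ x → trans (augment p w distinct x)
                            (trans (cong (_+ (δ a x - δ b x)) (net-value flow x)) (one-more (+ j) (δ a x) (δ b x)))
      where
      toggled⊆S : toggleAll p X ⊆ₛ _
      toggled⊆S {e} e∈X' with e ∈? p
      ... | yes e∈p = Walks.walk-edges (residual X) p w e∈p
      ... | no  e∉p = X⊆S (toggleAll-∉-∈ p e∉p e∈X')
      one-more : ∀ ι α β → ι * (α - β) + (α - β) ≡ (1ℤ + ι) * (α - β)
      one-more = solve-∀

    crossing : EdgeSet G → Subset n → ℤ
    crossing X R = ∑[ e < m G ] (χ X e * (χ R (tail G e) - χ R (head G e)))

    ∑-weighted-net : ∀ X (w : Fin n → ℤ) →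
                     ∑[ x < n ] (w x * net X x) ≡ ∑[ e < m G ] (χ X e * (w (tail G e) - w (head G e)))
    ∑-weighted-net X w = begin
      ∑[ x < n ] (w x * net X x)
        ≡⟨ sum-cong-≗ (λ x → *-distribˡ-sum (w x) (λ e → χ X e * incidence G e x)) ⟩
      ∑[ x < n ] ∑[ e < m G ] (w x * (χ X e * incidence G e x))
        ≡⟨ ∑-comm (λ x e → w x * (χ X e * incidence G e x)) ⟩
      ∑[ e < m G ] ∑[ x < n ] (w x * (χ X e * incidence G e x))
        ≡⟨ sum-cong-≗ (λ e → sum-cong-≗ (λ x → swap-factors (w x) (χ X e) (incidence G e x))) ⟩
      ∑[ e < m G ] ∑[ x < n ] (χ X e * (w x * incidence G e x))
        ≡⟨ sum-cong-≗ (λ e → *-distribˡ-sum (χ X e) (λ x → w x * incidence G e x)) ⟨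
      ∑[ e < m G ] (χ X e * ∑[ x < n ] (w x * incidence G e x))
        ≡⟨ sum-cong-≗ (λ e → cong (χ X e *_) (∑-δ-difference w (tail G e) (head G e))) ⟩
      ∑[ e < m G ] (χ X e * (w (tail G e) - w (head G e)))
        ∎
      where
      open ≡-Reasoning
      swap-factors : ∀ ω ξ ι → ω * (ξ * ι) ≡ ξ * (ω * ι)
      swap-factors = solve-∀

    crossing-flow : ∀ {X j a b} R → IsFlow X j a b → a ∈ₛ R → b ∉ₛ R → crossing X R ≡ + j
    crossing-flow {X} {j} {a} {b} R flow a∈R b∉R = begin
      crossing X R
        ≡⟨ ∑-weighted-net X (χ R) ⟨
      ∑[ x < n ] (χ R x * net X x)
        ≡⟨ sum-cong-≗ (λ x → cong (χ R x *_) (net-value flow x)) ⟩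
      ∑[ x < n ] (χ R x * (+ j * (δ a x - δ b x)))
        ≡⟨ sum-cong-≗ (λ x → reassociate (χ R x) (+ j) (δ a x - δ b x)) ⟩
      ∑[ x < n ] (+ j * χ R x * (δ a x - δ b x))
        ≡⟨ ∑-δ-difference (λ x → + j * χ R x) a b ⟩
      + j * χ R a - + j * χ R b
        ≡⟨ cong₂ (λ α β → + j * 𝟙 α - + j * 𝟙 β) ([]=⇒lookup a∈R) (lookup-∉ b∉R) ⟩
      + j * 1ℤ - + j * 0ℤ
        ≡⟨ unit (+ j) ⟩
      + j
        ∎
      where
      open ≡-Reasoning
      reassociate : ∀ ρ ι d → ρ * (ι * d) ≡ ι * ρ * d
      reassociate = solve-∀
      unit : ∀ ι → ι * 1ℤ - ι * 0ℤ ≡ ι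
      unit = solve-∀

    private
      crossing-term-mono : ∀ y z r s → (y ≡ true → r ≡ true → s ≡ false → z ≡ true) →
                           (z ≡ true → s ≡ true → r ≡ true) → 𝟙 y * (𝟙 r - 𝟙 s) ≤ 𝟙 z * (𝟙 r - 𝟙 s)
      crossing-term-mono false false r     s     _     _     = ℤ.≤-refl
      crossing-term-mono true  true  r     s     _     _     = ℤ.≤-refl
      crossing-term-mono true  false true  true  _     _     = ℤ.≤-refl
      crossing-term-mono true  false false false _     _     = ℤ.≤-refl
      crossing-term-mono true  false false true  _     _     = -≤+
      crossing-term-mono true  false true  false leave _     with () ← leave refl refl refl
      crossing-term-mono false true  true  true  _     _     = ℤ.≤-refl
      crossing-term-mono false true  false false _     _     = ℤ.≤-refl
      crossing-term-mono false true  true  false _     _     = +≤+ ℕ.z≤n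
      crossing-term-mono false true  false true  _     enter with () ← enter refl refl

    crossing-mono : ∀ {Y Z : EdgeSet G} R →
                    (∀ {e} → e ∈ₛ Y → tail G e ∈ₛ R → head G e ∉ₛ R → e ∈ₛ Z) →
                    (∀ {e} → e ∈ₛ Z → head G e ∈ₛ R → tail G e ∈ₛ R) →
                    crossing Y R ≤ crossing Z R
    crossing-mono {Y} {Z} R leave enter = ∑-mono-≤ λ e →
      crossing-term-mono (lookup Y e) (lookup Z e) (lookup R (tail G e)) (lookup R (head G e))
        (λ y r s → []=⇒lookup (leave (lookup⇒[]= e Y y) (lookup⇒[]= _ R r)
                                      (λ h∈R → true≢false (trans (sym ([]=⇒lookup h∈R)) s))))
        (λ z s → []=⇒lookup (enter (lookup⇒[]= e Z z) (lookup⇒[]= _ R s)))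
      where
      true≢false : true ≢ false
      true≢false ()

    flow-value-≤ : ∀ {X Y j J u v a b} R →
                   IsFlow Y J a b → a ∈ₛ R → b ∉ₛ R → IsFlow X j u v → u ∈ₛ R → v ∉ₛ R →
                   (∀ {e} → e ∈ₛ Y → tail G e ∈ₛ R → head G e ∉ₛ R → e ∈ₛ X) →
                   (∀ {e} → e ∈ₛ X → head G e ∈ₛ R → tail G e ∈ₛ R) → J ℕ.≤ j
    flow-value-≤ {X} {Y} {j} {J} R flowY a∈R b∉R flowX u∈R v∉R leave enter = ℤ.drop‿+≤+ (begin
      + J           ≡⟨ crossing-flow R flowY a∈R b∉R ⟨
      crossing Y R  ≤⟨ crossing-mono R leave enter ⟩
      crossing X R  ≡⟨ crossing-flow R flowX u∈R v∉R ⟩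
      + j           ∎)
      where open ℤ.≤-Reasoning

    disjoint-paths⇒IsFlow : ∀ {S a b} J (P : Fin J → List Edge) → (∀ i → IsPath G S a b (P i)) → Disjoint P →
                            Σ (EdgeSet G) λ Y → Y ⊆ₛ S × IsFlow Y J a b ×
                                                (∀ {e} → e ∈ₛ Y → Σ (Fin J) λ i → e ∈ P i)
    disjoint-paths⇒IsFlow zero    P paths disjoint = ⊥ , ⊥⊆ , empty-flow , ⊥-elim ∘ ∉⊥
    disjoint-paths⇒IsFlow (suc J) P paths disjoint
      with disjoint-paths⇒IsFlow J (P ∘ suc) (paths ∘ suc) (Disjoint-tail disjoint)
    ... | Y , Y⊆S , flow , origin = toggleAll p Y , proj₁ augmented , proj₂ augmented , origin'
      where
      p = P zero
      p∉Y : ∀ {e} → e ∈ p → e ∉ₛ Y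
      p∉Y e∈p e∈Y = let i , e∈Pi = origin e∈Y in disjoint zero (suc i) (λ ()) _ e∈p e∈Pi
      augmented = augment-flow p Y⊆S flow (residual-walk p p∉Y (proj₁ (paths zero))) (path-edges-unique p (paths zero))
      origin' : ∀ {e} → e ∈ₛ toggleAll p Y → Σ (Fin (suc J)) λ i → e ∈ P i
      origin' {e} e∈Y' with e ∈? p
      ... | yes e∈p = zero , e∈p
      ... | no  e∉p = let i , e∈Pi = origin (toggleAll-∉-∈ p e∉p e∈Y') in suc i , e∈Pi

    FlowAtLeast⇒IsFlow : ∀ {S a b J} → FlowAtLeast G S a b J → Σ (EdgeSet G) λ Y → Y ⊆ₛ S × IsFlow Y J a b
    FlowAtLeast⇒IsFlow {J = J} (ps , paths , disjoint) =
      let Y , Y⊆S , flow , _ = disjoint-paths⇒IsFlow J (lookup ps) paths disjoint in Y , Y⊆S , flow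

    -- augmenting the remainder along p gives back X
    cancel-path : ∀ {X j u v} p → IsFlow X (suc j) u v → IsWalk G X u v p → Unique p → IsFlow (toggleAll p X) j u v
    cancel-path {X} {j} {u} {v} p flow p-walk distinct = conserves λ x → begin
      net X' x
        ≡⟨ add-subtract (net X' x) (δ u x - δ v x) ⟩
      net X' x + (δ u x - δ v x) - (δ u x - δ v x)
        ≡⟨ cong (_- (δ u x - δ v x)) (augment p back distinct x) ⟨
      net (toggleAll p X') x - (δ u x - δ v x)
        ≡⟨ cong (_- (δ u x - δ v x)) (net-cong {toggleAll p X'} {X} (toggleAll-involutive p distinct) x) ⟩
      net X x - (δ u x - δ v x)
        ≡⟨ cong (_- (δ u x - δ v x)) (net-value flow x) ⟩
      + suc j * (δ u x - δ v x) - (δ u x - δ v x)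
        ≡⟨ one-less (+ j) (δ u x - δ v x) ⟩
      + j * (δ u x - δ v x)
        ∎
      where
      open ≡-Reasoning
      X' = toggleAll p X
      back = residual-walk p (toggleAll-removes p distinct (walk-edges p p-walk)) p-walk
      add-subtract : ∀ ν d → ν ≡ ν + d - d
      add-subtract = solve-∀
      one-less : ∀ ι d → (1ℤ + ι) * d - d ≡ ι * d
      one-less = solve-∀

    IsFlow⇒WalksAtLeast : ∀ {u v} j X → IsFlow X j u v → WalksAtLeast X u v j
    IsFlow⇒WalksAtLeast zero X _ = (λ ()) , (λ ()) , λ ()
    IsFlow⇒WalksAtLeast {u} {v} (suc j) X flow with Reachability.reachable-or-cut G X u v
    ... | inj₂ (R , u∈R , v∉R , closed) =
      ⊥-elim (n≮0 (flow-value-≤ R flow u∈R v∉R empty-flow u∈R v∉R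
                     (λ e∈X t∈R h∉R → ⊥-elim (h∉R (closed e∈X t∈R))) (⊥-elim ∘ ∉⊥)))
    ... | inj₁ (es , w) with walk⇒path es w
    ...   | p , path@(p-walk , _) , _ = p Vector.∷ W , walks , Disjoint-∷ p#W disjoint
      where
      distinct = path-edges-unique p path
      p⊆X = walk-edges p p-walk
      rest = IsFlow⇒WalksAtLeast j (toggleAll p X) (cancel-path p flow p-walk distinct)
      W = proj₁ rest
      walks : ∀ i → IsWalk G X u v ((p Vector.∷ W) i)
      walks zero    = p-walk
      walks (suc i) = IsWalk-mono (W i) (toggleAll-⊆ p distinct p⊆X) (proj₁ (proj₂ rest) i)
      p#W : ∀ i {e} → e ∈ p → e ∉ W i
      p#W i e∈p e∈Wi = toggleAll-removes p distinct p⊆X e∈p (walk-edges (W i) (proj₁ (proj₂ rest) i) e∈Wi)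
      disjoint = proj₂ (proj₂ rest)

    flow-trans : ∀ {S u w v J} → FlowAtLeast G S u w J → FlowAtLeast G S w v J → FlowAtLeast G S u v J
    flow-trans {S} {u} {w} {v} {J} P Q =
      let X , X⊆S , flow = maximal J ≤-refl in walks⇒flow (walks-mono X⊆S (IsFlow⇒WalksAtLeast J X flow))
      where
      maximal : ∀ j → j ℕ.≤ J → Σ (EdgeSet G) λ X → X ⊆ₛ S × IsFlow X j u v
      maximal zero    _   = ⊥ , ⊥⊆ , empty-flow
      maximal (suc j) j<J with maximal j (<⇒≤ j<J)
      ... | X , X⊆S , flow with Reachability.reachable-or-cut (residual X) S u v
      ...   | inj₁ (es , walk) =
        let p , path , _ = Walks.walk⇒path (residual X) es walk
        in toggleAll p X , augment-flow p X⊆S flow (proj₁ path) (Walks.path-edges-unique (residual X) p path)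
      ...   | inj₂ (R , u∈R , v∉R , closed) = ⊥-elim (<⇒≱ j<J J≤j)
        where
        leave : ∀ {Y} → Y ⊆ₛ S → ∀ {e} → e ∈ₛ Y → tail G e ∈ₛ R → head G e ∉ₛ R → e ∈ₛ X
        leave Y⊆S {e} e∈Y t∈R h∉R with e ∈?ₛ X
        ... | yes e∈X = e∈X
        ... | no  e∉X = ⊥-elim (h∉R (subst (_∈ₛ R) (cong proj₂ (residual-∉ e∉X))
                                       (closed (Y⊆S e∈Y) (subst (_∈ₛ R) (cong proj₁ (sym (residual-∉ e∉X))) t∈R))))
        enter : ∀ {e} → e ∈ₛ X → head G e ∈ₛ R → tail G e ∈ₛ R
        enter e∈X h∈R = subst (_∈ₛ R) (cong proj₂ (residual-∈ e∈X))
                          (closed (X⊆S e∈X) (subst (_∈ₛ R) (cong proj₁ (sym (residual-∈ e∈X))) h∈R))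
        J≤j : J ℕ.≤ j
        J≤j with w ∈?ₛ R
        ... | yes w∈R = let Y , Y⊆S , flowQ = FlowAtLeast⇒IsFlow Q in
                        flow-value-≤ R flowQ w∈R v∉R flow u∈R v∉R (leave Y⊆S) enter
        ... | no  w∉R = let Y , Y⊆S , flowP = FlowAtLeast⇒IsFlow P in
                        flow-value-≤ R flowP u∈R w∉R flow u∈R v∉R (leave Y⊆S) enter

open import Data.Nat using (_≤_; _+_; _*_; z≤n; s≤s)
open import Data.Nat.Properties using (≤-trans; ≤-reflexive; +-suc; m≤n⇒m≤1+n; +-mono-≤; +-identityʳ; *-identityˡ)
open import Data.Fin.Properties
  using (splitAt-↑ˡ; splitAt-↑ʳ; splitAt⁻¹-↑ˡ; splitAt⁻¹-↑ʳ; ↑ˡ-injective; ↑ʳ-injective;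
         remQuot-combine; combine-remQuot; combine-injectiveʳ; inject≤-injective)

↑ˡ≢↑ʳ : ∀ {a b} (i : Fin a) (j : Fin b) → i ↑ˡ b ≢ a ↑ʳ j
↑ˡ≢↑ʳ {a} {b} i j eq with () ← trans (sym (splitAt-↑ˡ a i b)) (trans (cong (splitAt a) eq) (splitAt-↑ʳ a b j))

prefix : ∀ {a b} → Subset (a + b) → Subset a
prefix {b = b} p = tabulate λ i → lookup p (i ↑ˡ b)

prefix-∈ : ∀ {a b} {p : Subset (a + b)} {i} → i ↑ˡ b ∈ₛ p → i ∈ₛ prefix p
prefix-∈ {i = i} i∈p = lookup⇒[]= i _ (trans (lookup∘tabulate _ i) ([]=⇒lookup i∈p))

∈-prefix : ∀ {a b} {p : Subset (a + b)} {i} → i ∈ₛ prefix p → i ↑ˡ b ∈ₛ p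
∈-prefix {p = p} {i} i∈p = lookup⇒[]= _ p (trans (sym (lookup∘tabulate _ i)) ([]=⇒lookup i∈p))

∣prefix∣≤ : ∀ {a b} (p : Subset (a + b)) → ∣ prefix {a} p ∣ ≤ ∣ p ∣
∣prefix∣≤ {zero}  p           = z≤n
∣prefix∣≤ {suc a} (true ∷ p)  = s≤s (∣prefix∣≤ {a} p)
∣prefix∣≤ {suc a} (false ∷ p) = ∣prefix∣≤ {a} p

∣p∪q∣≤∣p∣+∣q∣ : ∀ {a} (p q : Subset a) → ∣ p ∪ q ∣ ≤ ∣ p ∣ + ∣ q ∣
∣p∪q∣≤∣p∣+∣q∣ []          []          = z≤n
∣p∪q∣≤∣p∣+∣q∣ (true ∷ p)  (true ∷ q)  =
  s≤s (≤-trans (m≤n⇒m≤1+n (∣p∪q∣≤∣p∣+∣q∣ p q)) (≤-reflexive (sym (+-suc ∣ p ∣ ∣ q ∣))))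
∣p∪q∣≤∣p∣+∣q∣ (true ∷ p)  (false ∷ q) = s≤s (∣p∪q∣≤∣p∣+∣q∣ p q)
∣p∪q∣≤∣p∣+∣q∣ (false ∷ p) (true ∷ q)  =
  ≤-trans (s≤s (∣p∪q∣≤∣p∣+∣q∣ p q)) (≤-reflexive (sym (+-suc ∣ p ∣ ∣ q ∣)))
∣p∪q∣≤∣p∣+∣q∣ (false ∷ p) (false ∷ q) = ∣p∪q∣≤∣p∣+∣q∣ p q

∣p++⊥∣≡∣p∣ : ∀ {a b} (p : Subset a) → ∣ p ++ᵥ ⊥ {b} ∣ ≡ ∣ p ∣
∣p++⊥∣≡∣p∣ {b = b} []  = ∣⊥∣≡0 b
∣p++⊥∣≡∣p∣ (true ∷ p)  = cong suc (∣p++⊥∣≡∣p∣ p)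
∣p++⊥∣≡∣p∣ (false ∷ p) = ∣p++⊥∣≡∣p∣ p

↑ˡ-∈-++ : ∀ {a b} {p : Subset a} {q : Subset b} {i} → i ∈ₛ p → i ↑ˡ b ∈ₛ p ++ᵥ q
↑ˡ-∈-++ {p = p} {q} {i} i∈p = lookup⇒[]= _ (p ++ᵥ q) (trans (lookup-++ˡ p q i) ([]=⇒lookup i∈p))

↑ˡ-∈-++⁻ : ∀ {a b} {p : Subset a} {q : Subset b} {i} → i ↑ˡ b ∈ₛ p ++ᵥ q → i ∈ₛ p
↑ˡ-∈-++⁻ {p = p} {q} {i} i∈ = lookup⇒[]= i p (trans (sym (lookup-++ˡ p q i)) ([]=⇒lookup i∈))

↑ʳ-∈-++⁻ : ∀ {a b} {p : Subset a} {q : Subset b} {j} → a ↑ʳ j ∈ₛ p ++ᵥ q → j ∈ₛ q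
↑ʳ-∈-++⁻ {p = p} {q} {j} j∈ = lookup⇒[]= j q (trans (sym (lookup-++ʳ p q j)) ([]=⇒lookup j∈))

module Extension {n : ℕ} (G : Digraph n) (s t : Fin n) (c : ℕ) where

  open Walks

  private
    N : ℕ
    N = n * c

    arcToS arcFromT : Fin N → Fin n × Fin n
    arcToS   r = proj₁ (remQuot c r) , s
    arcFromT r = t , proj₁ (remQuot c r)

    newArc : Fin (N + N) → Fin n × Fin n
    newArc = [ arcToS , arcFromT ]′ ∘ splitAt N

  G⁺ : Digraph n
  G⁺ = record { m = m G + (N + N) ; edges = edges G ++ᵥ tabulate newArc }

  embed : Fin (m G) → Fin (m G⁺)
  embed e = e ↑ˡ (N + N)

  toSource fromTarget : Fin n → Fin c → Fin (m G⁺)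
  toSource   v i = m G ↑ʳ (combine v i ↑ˡ N)
  fromTarget v i = m G ↑ʳ (N ↑ʳ combine v i)

  embed-edge : ∀ e → lookup (edges G⁺) (embed e) ≡ lookup (edges G) e
  embed-edge = lookup-++ˡ (edges G) _

  toSource-edge : ∀ v i → lookup (edges G⁺) (toSource v i) ≡ (v , s)
  toSource-edge v i = begin
    lookup (edges G⁺) (toSource v i)              ≡⟨ lookup-++ʳ (edges G) _ _ ⟩
    lookup (tabulate newArc) (combine v i ↑ˡ N)   ≡⟨ lookup∘tabulate newArc _ ⟩
    newArc (combine v i ↑ˡ N)                     ≡⟨ cong [ arcToS , arcFromT ]′ (splitAt-↑ˡ N (combine v i) N) ⟩
    arcToS (combine v i)                          ≡⟨ cong (λ vi → proj₁ vi , s) (remQuot-combine v i) ⟩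
    (v , s)                                       ∎
    where open ≡-Reasoning

  fromTarget-edge : ∀ v i → lookup (edges G⁺) (fromTarget v i) ≡ (t , v)
  fromTarget-edge v i = begin
    lookup (edges G⁺) (fromTarget v i)            ≡⟨ lookup-++ʳ (edges G) _ _ ⟩
    lookup (tabulate newArc) (N ↑ʳ combine v i)   ≡⟨ lookup∘tabulate newArc _ ⟩
    newArc (N ↑ʳ combine v i)                     ≡⟨ cong [ arcToS , arcFromT ]′ (splitAt-↑ʳ N N (combine v i)) ⟩
    arcFromT (combine v i)                        ≡⟨ cong (λ vi → t , proj₁ vi) (remQuot-combine v i) ⟩
    (t , v)                                       ∎
    where open ≡-Reasoning

  data Arc : Fin (m G⁺) → Set where
    original  : ∀ e → Arc (embed e)
    intoS     : ∀ v i → Arc (toSource v i)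
    outOfT    : ∀ v i → Arc (fromTarget v i)

  arc : ∀ e' → Arc e'
  arc e' with splitAt (m G) e' in split₁
  ... | inj₁ e = subst Arc (splitAt⁻¹-↑ˡ split₁) (original e)
  ... | inj₂ q with splitAt N q in split₂
  ...   | inj₁ r = subst Arc (trans (cong (λ r' → m G ↑ʳ (r' ↑ˡ N)) (combine-remQuot {n} c r))
                                   (trans (cong (m G ↑ʳ_) (splitAt⁻¹-↑ˡ split₂)) (splitAt⁻¹-↑ʳ split₁)))
                            (intoS (proj₁ (remQuot {n} c r)) (proj₂ (remQuot {n} c r)))
  ...   | inj₂ r = subst Arc (trans (cong (λ r' → m G ↑ʳ (N ↑ʳ r')) (combine-remQuot {n} c r))
                                   (trans (cong (m G ↑ʳ_) (splitAt⁻¹-↑ʳ split₂)) (splitAt⁻¹-↑ʳ split₁)))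
                            (outOfT (proj₁ (remQuot {n} c r)) (proj₂ (remQuot {n} c r)))

  embed≢toSource : ∀ {e v i} → embed e ≢ toSource v i
  embed≢toSource = ↑ˡ≢↑ʳ _ _

  embed≢fromTarget : ∀ {e v i} → embed e ≢ fromTarget v i
  embed≢fromTarget = ↑ˡ≢↑ʳ _ _

  toSource≢fromTarget : ∀ {v i v' i'} → toSource v i ≢ fromTarget v' i'
  toSource≢fromTarget {v} {i} {v'} {i'} = ↑ˡ≢↑ʳ (combine v i) (combine v' i') ∘ ↑ʳ-injective (m G) _ _

  toSource-injective : ∀ {v i v' i'} → toSource v i ≡ toSource v' i' → i ≡ i'
  toSource-injective {v} {i} {v'} {i'} =
    combine-injectiveʳ v i v' i' ∘ ↑ˡ-injective N (combine v i) (combine v' i') ∘ ↑ʳ-injective (m G) _ _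

  fromTarget-injective : ∀ {v i v' i'} → fromTarget v i ≡ fromTarget v' i' → i ≡ i'
  fromTarget-injective {v} {i} {v'} {i'} =
    combine-injectiveʳ v i v' i' ∘ ↑ʳ-injective N (combine v i) (combine v' i') ∘ ↑ʳ-injective (m G) _ _

  record Extends (S : EdgeSet G) (T : EdgeSet G⁺) : Set where
    field
      embed-∈      : ∀ {e} → e ∈ₛ S → embed e ∈ₛ T
      toSource-∈   : ∀ v i → toSource v i ∈ₛ T
      fromTarget-∈ : ∀ v i → fromTarget v i ∈ₛ T
  open Extends

  -- the part of a walk after its last arc into s, or all of it if there is none
  walk-down : ∀ {T x} W → IsWalk G⁺ T x t W →
              Σ (List (Fin (m G))) λ W₀ → (IsWalk G (prefix T) x t W₀ ⊎ IsWalk G (prefix T) s t W₀) ×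
                                          (∀ {e} → e ∈ W₀ → embed e ∈ W)
  walk-down []       x≡t                   = [] , inj₁ x≡t , λ ()
  walk-down {T} (e' ∷ W) (e'∈T , tail≡x , w) with arc e'
  ... | outOfT v i = [] , inj₁ (trans (sym tail≡x) (cong proj₁ (fromTarget-edge v i))) , λ ()
  ... | intoS v i with walk-down W w
  ...   | W₀ , inj₁ w₀ , W₀⊆W =
    W₀ , inj₂ (subst (λ y → IsWalk G (prefix T) y t W₀) (cong proj₂ (toSource-edge v i)) w₀) , there ∘ W₀⊆W
  ...   | W₀ , inj₂ w₀ , W₀⊆W = W₀ , inj₂ w₀ , there ∘ W₀⊆W
  walk-down {T} (e' ∷ W) (e'∈T , tail≡x , w) | original e with walk-down W w
  ...   | W₀ , inj₂ w₀ , W₀⊆W = W₀ , inj₂ w₀ , there ∘ W₀⊆W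
  ...   | W₀ , inj₁ w₀ , W₀⊆W =
    e ∷ W₀ ,
    inj₁ (prefix-∈ e'∈T , trans (cong proj₁ (sym (embed-edge e))) tail≡x ,
          subst (λ y → IsWalk G (prefix T) y t W₀) (cong proj₂ (embed-edge e)) w₀) ,
    λ { (here refl) → here refl ; (there e∈W₀) → there (W₀⊆W e∈W₀) }

  flow-down : ∀ {T j} → FlowAtLeast G⁺ T s t j → FlowAtLeast G (prefix T) s t j
  flow-down (ps , paths , disjoint) =
    walks⇒flow G ((λ i → proj₁ (down i)) , (λ i → reduce (proj₁ (proj₂ (down i)))) ,
                  Disjoint-reflect embed (λ i → proj₂ (proj₂ (down i))) disjoint)
    where
    down = λ i → walk-down (lookup ps i) (proj₁ (paths i))

  walk-up : ∀ {S T x y} p → (∀ {e} → e ∈ₛ S → embed e ∈ₛ T) → IsWalk G S x y p → IsWalk G⁺ T x y (map embed p)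
  walk-up []      _    x≡y              = x≡y
  walk-up {T = T} {y = y} (e ∷ p) S⇒T (e∈S , tail≡x , w) =
    S⇒T e∈S , trans (cong proj₁ (embed-edge e)) tail≡x ,
    subst (λ z → IsWalk G⁺ T z y (map embed p)) (cong proj₂ (sym (embed-edge e))) (walk-up p S⇒T w)

  -- route the i-th path through the i-th copy of the arcs a → s and t → b
  flow-up : ∀ {S T j} → j ≤ c → Extends S T → FlowAtLeast G S s t j → ∀ a b → FlowAtLeast G⁺ T a b j
  flow-up {S} {T} {j} j≤c ext (ps , paths , disjoint) a b = walks⇒flow G⁺ (W , walks , disjointW)
    where
    copy : Fin j → Fin c
    copy i = inject≤ i j≤c
    W : Fin j → List (Fin (m G⁺))
    W i = toSource a (copy i) ∷ (map embed (lookup ps i) ++ fromTarget b (copy i) ∷ [])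
    walks : ∀ i → IsWalk G⁺ T a b (W i)
    walks i =
      toSource-∈ ext a (copy i) , cong proj₁ (toSource-edge a (copy i)) ,
      subst (λ z → IsWalk G⁺ T z b (map embed (lookup ps i) ++ fromTarget b (copy i) ∷ []))
            (sym (cong proj₂ (toSource-edge a (copy i))))
            (IsWalk-++ G⁺ (map embed (lookup ps i)) _ (walk-up (lookup ps i) (embed-∈ ext) (proj₁ (paths i)))
              (fromTarget-∈ ext b (copy i) , cong proj₁ (fromTarget-edge b (copy i)) , cong proj₂ (fromTarget-edge b (copy i))))
    embed∈W : ∀ {i e} → embed e ∈ W i → e ∈ lookup ps i
    embed∈W (here eq) = ⊥-elim (embed≢toSource eq)
    embed∈W {i} (there e∈) with ∈-++⁻ (map embed (lookup ps i)) e∈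
    ... | inj₁ e∈map =
      let e' , e'∈ , eq = ∈-map⁻ embed e∈map in subst (_∈ lookup ps i) (sym (↑ˡ-injective _ _ _ eq)) e'∈
    ... | inj₂ (here eq) = ⊥-elim (embed≢fromTarget eq)
    toSource∈W : ∀ {i v q} → toSource v q ∈ W i → q ≡ copy i
    toSource∈W (here eq) = toSource-injective eq
    toSource∈W {i} (there e∈) with ∈-++⁻ (map embed (lookup ps i)) e∈
    ... | inj₁ e∈map = let _ , _ , eq = ∈-map⁻ embed e∈map in ⊥-elim (embed≢toSource (sym eq))
    ... | inj₂ (here eq) = ⊥-elim (toSource≢fromTarget eq)
    fromTarget∈W : ∀ {i v q} → fromTarget v q ∈ W i → q ≡ copy i
    fromTarget∈W (here eq) = ⊥-elim (toSource≢fromTarget (sym eq))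
    fromTarget∈W {i} (there e∈) with ∈-++⁻ (map embed (lookup ps i)) e∈
    ... | inj₁ e∈map = let _ , _ , eq = ∈-map⁻ embed e∈map in ⊥-elim (embed≢fromTarget (sym eq))
    ... | inj₂ (here eq) = fromTarget-injective eq
    disjointW : Disjoint W
    disjointW i i' i≢i' e' e'∈Wi e'∈Wi' with arc e'
    ... | original e = disjoint i i' i≢i' e (embed∈W e'∈Wi) (embed∈W e'∈Wi')
    ... | intoS v q  = i≢i' (inject≤-injective _ _ i i' (trans (sym (toSource∈W e'∈Wi)) (toSource∈W e'∈Wi')))
    ... | outOfT v q = i≢i' (inject≤-injective _ _ i i' (trans (sym (fromTarget∈W e'∈Wi)) (fromTarget∈W e'∈Wi')))

  extension-reflects-flow : ∀ {S T T' κ j} → j ≤ c → j ≤ κ → Extends S T →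
                            (GlobalLamKAtLeast κ G⁺ T j → GlobalLamKAtLeast κ G⁺ T' j) →
                            FlowAtLeast G S s t j → FlowAtLeast G (prefix T') s t j
  extension-reflects-flow j≤c j≤κ ext preserve P =
    flow-down (proj₁ (proj₂ (preserve (j≤κ , λ a b → flow-up j≤c ext P a b , flow-up j≤c ext P b a)) s t))

module _ {n : ℕ} (G : Digraph n) where

  ∈-minus : ∀ {H F : EdgeSet G} {e} → e ∈ₛ H → e ∉ₛ F → e ∈ₛ minus G H F
  ∈-minus e∈H e∉F = x∈p∩q⁺ (e∈H , x∉p⇒x∈∁p e∉F)

  minus-∈ : ∀ {H F : EdgeSet G} {e} → e ∈ₛ minus G H F → e ∈ₛ H × e ∉ₛ F
  minus-∈ {H} {F} e∈ = let e∈H , e∈∁F = x∈p∩q⁻ H (∁ F) e∈ in e∈H , x∈∁p⇒x∉p e∈∁F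

  minus-mono : ∀ {H H' F : EdgeSet G} → H ⊆ₛ H' → minus G H F ⊆ₛ minus G H' F
  minus-mono H⊆H' e∈ = let e∈H , e∉F = minus-∈ e∈ in ∈-minus (H⊆H' e∈H) e∉F

  LamKAtLeast-mono : ∀ {κ S S' a b j} → S ⊆ₛ S' → LamKAtLeast κ G S a b j → LamKAtLeast κ G S' a b j
  LamKAtLeast-mono S⊆S' (j≤κ , P , Q) = j≤κ , Walks.flow-mono G S⊆S' P , Walks.flow-mono G S⊆S' Q

  SameLamK-from-⊆ : ∀ {κ S S' a b} → S ⊆ₛ S' → (∀ j → LamKAtLeast κ G S' a b j → LamKAtLeast κ G S a b j) →
                    SameLamK κ G S S' a b
  SameLamK-from-⊆ S⊆S' back j = mk⇔ (LamKAtLeast-mono S⊆S') (back j)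

SameGlobalLamK-from-source : ∀ {n κ} (G : Digraph (suc n)) {S S' : EdgeSet G} → S ⊆ₛ S' →
                             (∀ x j → LamKAtLeast κ G S' zero x j → LamKAtLeast κ G S zero x j) →
                             SameGlobalLamK κ G S S'
SameGlobalLamK-from-source G S⊆S' back j = mk⇔
  (λ (j≤κ , conn) → j≤κ , λ a b → flow-mono S⊆S' (proj₁ (conn a b)) , flow-mono S⊆S' (proj₂ (conn a b)))
  (λ (j≤κ , conn) → j≤κ , λ a b → via j≤κ conn a b , via j≤κ conn b a)
  where
  open Walks G using (flow-mono)
  via = λ j≤κ conn a b → Menger.flow-trans G (proj₂ (proj₂ (back a j (j≤κ , conn zero a))))
                                             (proj₁ (proj₂ (back b j (j≤κ , conn zero b))))

SameGlobalLamK-empty : ∀ {κ} (G : Digraph 0) {S S' : EdgeSet G} → SameGlobalLamK κ G S S'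
SameGlobalLamK-empty G j = mk⇔ (λ (j≤κ , _) → j≤κ , λ ()) (λ (j≤κ , _) → j≤κ , λ ())

module _ {n : ℕ} (G : Digraph n) (s t : Fin n) (k : ℕ) where

  open Extension G s t k

  private
    pad : EdgeSet G → EdgeSet G⁺
    pad F = F ++ᵥ ⊥

    new-arc-∉-pad : ∀ {F} q → m G ↑ʳ q ∉ₛ pad F
    new-arc-∉-pad {F} q = ∉⊥ ∘ ↑ʳ-∈-++⁻ {p = F}

  FT-reflects-flow : 1 ≤ k → (H⁺ : EdgeSet G⁺) → GlobalFTPreserver k G⁺ H⁺ →
                     (F : EdgeSet G) → ∣ F ∣ ≤ k → ∀ {j} → j ≤ 1 →
                     FlowAtLeast G (minus G ⊤ F) s t j → FlowAtLeast G (minus G (prefix H⁺) F) s t j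
  FT-reflects-flow 1≤k H⁺ preserves F ∣F∣≤k j≤1 P =
    Walks.flow-mono G prefix-minus
      (extension-reflects-flow (≤-trans j≤1 1≤k) j≤1 extends
        (Equivalence.from (preserves (pad F) (subst (_≤ k) (sym (∣p++⊥∣≡∣p∣ F)) ∣F∣≤k) _)) P)
    where
    extends : Extends (minus G ⊤ F) (minus G⁺ ⊤ (pad F))
    extends = record
      { embed-∈      = λ e∈ → ∈-minus G⁺ ∈⊤ (proj₂ (minus-∈ G e∈) ∘ ↑ˡ-∈-++⁻)
      ; toSource-∈   = λ _ _ → ∈-minus G⁺ ∈⊤ (new-arc-∉-pad _)
      ; fromTarget-∈ = λ _ _ → ∈-minus G⁺ ∈⊤ (new-arc-∉-pad _)
      }
    prefix-minus : prefix (minus G⁺ H⁺ (pad F)) ⊆ₛ minus G (prefix H⁺) F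
    prefix-minus e∈ =
      let e∈H⁺ , e∉F⁺ = minus-∈ G⁺ {H⁺} {pad F} (∈-prefix e∈) in ∈-minus G (prefix-∈ e∈H⁺) (e∉F⁺ ∘ ↑ˡ-∈-++)

  Con-reflects-flow : (H⁺ : EdgeSet G⁺) → GlobalConPreserver k G⁺ H⁺ → ∀ {j} → j ≤ k →
                      FlowAtLeast G ⊤ s t j → FlowAtLeast G (prefix H⁺) s t j
  Con-reflects-flow H⁺ preserves j≤k =
    extension-reflects-flow j≤k j≤k extends (Equivalence.from (preserves _))
    where
    extends : Extends ⊤ ⊤
    extends = record { embed-∈ = λ _ → ∈⊤ ; toSource-∈ = λ _ _ → ∈⊤ ; fromTarget-∈ = λ _ _ → ∈⊤ }

m≤n⇒m≤1*n : ∀ {a b} → a ≤ b → a ≤ 1 * b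
m≤n⇒m≤1*n {b = b} a≤b = ≤-trans a≤b (≤-reflexive (sym (*-identityˡ b)))

∣⊥∣≤ : ∀ {a} b → ∣ ⊥ {a} ∣ ≤ b
∣⊥∣≤ {a} b = ≤-trans (≤-reflexive (∣⊥∣≡0 a)) z≤n

∣prefix∪prefix∣≤ : ∀ {a b B} (H₁ H₂ : Subset (a + b)) → ∣ H₁ ∣ ≤ B → ∣ H₂ ∣ ≤ B →
                   ∣ prefix {a} H₁ ∪ prefix H₂ ∣ ≤ 2 * B
∣prefix∪prefix∣≤ {a} {B = B} H₁ H₂ ∣H₁∣≤B ∣H₂∣≤B =
  ≤-trans (∣p∪q∣≤∣p∣+∣q∣ (prefix {a} H₁) (prefix H₂))
    (≤-trans (+-mono-≤ (≤-trans (∣prefix∣≤ {a} H₁) ∣H₁∣≤B) (≤-trans (∣prefix∣≤ {a} H₂) ∣H₂∣≤B))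
             (≤-reflexive (cong (B +_) (sym (+-identityʳ B)))))

module _ {k : ℕ} {B : ℕ → ℕ} where

  global⇒st-FT : 1 ≤ k → AllG k GlobalFTPreserver B → AllST k STFTPreserver (λ n → 2 * B n)
  global⇒st-FT 1≤k hyp n G s t =
    let H₁ , ∣H₁∣≤ , preserves₁ = hyp n (Extension.G⁺ G s t k)
        H₂ , ∣H₂∣≤ , preserves₂ = hyp n (Extension.G⁺ G t s k)
    in prefix H₁ ∪ prefix H₂ , ∣prefix∪prefix∣≤ {m G} H₁ H₂ ∣H₁∣≤ ∣H₂∣≤ ,
       λ F ∣F∣≤k → SameLamK-from-⊆ G (minus-mono G ⊆⊤) λ j (j≤1 , P , Q) →
         j≤1 ,
         Walks.flow-mono G (minus-mono G (p⊆p∪q _)) (FT-reflects-flow G s t k 1≤k H₁ preserves₁ F ∣F∣≤k j≤1 P) ,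
         Walks.flow-mono G (minus-mono G (q⊆p∪q _ _)) (FT-reflects-flow G t s k 1≤k H₂ preserves₂ F ∣F∣≤k j≤1 Q)

  global⇒st-Con : AllG k GlobalConPreserver B → AllST k STConPreserver (λ n → 2 * B n)
  global⇒st-Con hyp n G s t =
    let H₁ , ∣H₁∣≤ , preserves₁ = hyp n (Extension.G⁺ G s t k)
        H₂ , ∣H₂∣≤ , preserves₂ = hyp n (Extension.G⁺ G t s k)
    in prefix H₁ ∪ prefix H₂ , ∣prefix∪prefix∣≤ {m G} H₁ H₂ ∣H₁∣≤ ∣H₂∣≤ ,
       SameLamK-from-⊆ G ⊆⊤ λ j (j≤k , P , Q) →
         j≤k ,
         Walks.flow-mono G (p⊆p∪q _) (Con-reflects-flow G s t k H₁ preserves₁ j≤k P) ,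
         Walks.flow-mono G (q⊆p∪q _ _) (Con-reflects-flow G t s k H₂ preserves₂ j≤k Q)

  single-source⇒global-FT : AllSS k SSFTPreserver B → AllG k GlobalFTPreserver (λ n → 1 * B n)
  single-source⇒global-FT hyp zero    G = ⊥ , ∣⊥∣≤ {m G} _ , λ _ _ → SameGlobalLamK-empty G
  single-source⇒global-FT hyp (suc n) G =
    let H , ∣H∣≤ , preserves = hyp (suc n) G zero
    in H , m≤n⇒m≤1*n ∣H∣≤ ,
       λ F ∣F∣≤k → SameGlobalLamK-from-source G (minus-mono G ⊆⊤) λ x j → Equivalence.from (preserves F ∣F∣≤k x j)

  single-source⇒global-Con : AllSS k SSConPreserver B → AllG k GlobalConPreserver (λ n → 1 * B n)
  single-source⇒global-Con hyp zero    G = ⊥ , ∣⊥∣≤ {m G} _ , SameGlobalLamK-empty G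
  single-source⇒global-Con hyp (suc n) G =
    let H , ∣H∣≤ , preserves = hyp (suc n) G zero
    in H , m≤n⇒m≤1*n ∣H∣≤ , SameGlobalLamK-from-source G ⊆⊤ λ x j → Equivalence.from (preserves x j)

  all-pairs⇒single-source-FT : AllG k APFTPreserver B → AllSS k SSFTPreserver (λ n → 1 * B n)
  all-pairs⇒single-source-FT hyp n G s =
    let H , ∣H∣≤ , preserves = hyp n G in H , m≤n⇒m≤1*n ∣H∣≤ , λ F ∣F∣≤k → preserves F ∣F∣≤k s

  all-pairs⇒single-source-Con : AllG k APConPreserver B → AllSS k SSConPreserver (λ n → 1 * B n)
  all-pairs⇒single-source-Con hyp n G s =
    let H , ∣H∣≤ , preserves = hyp n G in H , m≤n⇒m≤1*n ∣H∣≤ , preserves s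

theoremA4 : (k : ℕ) → 1 ≤ k → (f : ℕ → ℕ → ℕ) →
    -- k-FT connectivity preserver family
    ((AllG k GlobalFTPreserver (λ n → f n k) →
       Σ ℕ λ C → AllST k STFTPreserver (λ n → C * f n k))
    × (AllSS k SSFTPreserver (λ n → f n k) →
       Σ ℕ λ C → AllG k GlobalFTPreserver (λ n → C * f n k))
    × (AllG k APFTPreserver (λ n → f n k) →
       Σ ℕ λ C → AllSS k SSFTPreserver (λ n → C * f n k)))
    ×
    -- k-connectivity preserver family
    ((AllG k GlobalConPreserver (λ n → f n k) →
       Σ ℕ λ C → AllST k STConPreserver (λ n → C * f n k))
    × (AllSS k SSConPreserver (λ n → f n k) →
       Σ ℕ λ C → AllG k GlobalConPreserver (λ n → C * f n k))
    × (AllG k APConPreserver (λ n → f n k) →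
       Σ ℕ λ C → AllSS k SSConPreserver (λ n → C * f n k)))
theoremA4 k 1≤k f =
  ( (λ hyp → 2 , global⇒st-FT 1≤k hyp)
  , (λ hyp → 1 , single-source⇒global-FT hyp)
  , (λ hyp → 1 , all-pairs⇒single-source-FT hyp) )
  ,
  ( (λ hyp → 2 , global⇒st-Con hyp)
  , (λ hyp → 1 , single-source⇒global-Con hyp)
  , (λ hyp → 1 , all-pairs⇒single-source-Con hyp) )
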